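{- Let $\varphi$ be a 2-SAT formula on variables $x_1,\dots,x_n$ with no trivial variables, no equivalent variables, and no clauses of the form $(x_i\vee x_j)$ (two positive literals). Let $E=\{e_1,\dots,e_n\}$; define $e_i\le_0 e_j$ iff $\varphi$ contains the clause $(x_i\vee\neg x_j)$, and $e_i\#_0 e_j$ iff $\varphi$ contains the clause $(\neg x_i\vee\neg x_j)$; let $\le$ be the reflexive and transitive closure of $\le_0$, and let $e_j\# e_\ell$ whenever there are $e_i,e_k$ with $e_i\le e_j$, $e_k\le e_\ell$ and $e_i\#_0e_k$. Then $\mathcal{E}_\varphi=(E,\le,\#)$ is an event structure, and its set of configurations $\mathcal{D}(\mathcal{E}_\varphi)$ coincides (via characteristic vectors) with the solution set of $\varphi$.
   Context: A 2-SAT formula is a conjunction of clauses of two literals; a solution is a $0/1$ assignment satisfying all clauses. A variable is trivial if it takes the same value in all solutions. Two nontrivial variables $x_i,x_j$ are equivalent if either $x_i=x_j$ in all solutions or $x_i=\neg x_j$ in all solutions. An event structure is a triple $(E,\le,\#)$ where $\le$ is a partial order on $E$, $\#$ is a binary irreflexive symmetric relation (conflict), $\{e'\le e\}$ is finite for each $e$, and $e\#e'$, $e'\le e''$ imply $e\#e''$. A configuration is a finite subset $c\subseteq E$ that is conflict-free and downward-closed; it corresponds to the assignment $S_c$ with $S_c(x_i)=1$ iff $e_i\in c$. -}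

module Defs where

open import Data.Nat using (ℕ)
open import Data.Fin using (Fin)
open import Data.Bool using (Bool; true; false; not)
open import Data.List using (List)
open import Data.List.Membership.Propositional using (_∈_)
open import Data.List.Relation.Unary.All using (All)
open import Data.Product using (_×_; _,_; ∃; ∃-syntax)
open import Data.Sum using (_⊎_)
open import Data.Empty using (⊥)
open import Relation.Nullary using (¬_)
open import Relation.Binary.PropositionalEquality using (_≡_; _≢_)
open import Relation.Binary.Construct.Closure.ReflexiveTransitive using (Star)
open import Function.Bundles using (_⇔_)

data Literal (n : ℕ) : Set where
  pos : Fin n → Literal n
  neg : Fin n → Literal n

Clause : ℕ → Set
Clause n = Literal n × Literal n

Formula : ℕ → Set
Formula n = List (Clause n)

Assignment : ℕ → Set
Assignment n = Fin n → Bool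

evalLit : ∀ {n} → Assignment n → Literal n → Bool
evalLit S (pos i) = S i
evalLit S (neg i) = not (S i)

satClause : ∀ {n} → Assignment n → Clause n → Set
satClause S (l₁ , l₂) = (evalLit S l₁ ≡ true) ⊎ (evalLit S l₂ ≡ true)

Solution : ∀ {n} → Formula n → Assignment n → Set
Solution φ S = All (satClause S) φ

-- φ contains the clause (l₁ ∨ l₂) (clauses are unordered: either order)
Contains : ∀ {n} → Formula n → Literal n → Literal n → Set
Contains φ l₁ l₂ = ((l₁ , l₂) ∈ φ) ⊎ ((l₂ , l₁) ∈ φ)

Trivial : ∀ {n} → Formula n → Fin n → Set
Trivial φ i = ∃[ b ] (∀ S → Solution φ S → S i ≡ b)

Equivalent : ∀ {n} → Formula n → Fin n → Fin n → Set
Equivalent φ i j =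
  ¬ Trivial φ i × ¬ Trivial φ j ×
  ((∀ S → Solution φ S → S i ≡ S j) ⊎ (∀ S → Solution φ S → S i ≡ not (S j)))

NoTrivialVars : ∀ {n} → Formula n → Set
NoTrivialVars {n} φ = (i : Fin n) → ¬ Trivial φ i

NoEquivalentVars : ∀ {n} → Formula n → Set
NoEquivalentVars {n} φ = (i j : Fin n) → i ≢ j → ¬ Equivalent φ i j

NoPositiveClauses : ∀ {n} → Formula n → Set
NoPositiveClauses {n} φ = (i j : Fin n) → ¬ Contains φ (pos i) (pos j)

-- Event structure on the finite event set Fin n
-- (finiteness of {e' ≤ e} is automatic since Fin n is finite)
record IsEventStructure (n : ℕ) (_≤_ : Fin n → Fin n → Set) (_#_ : Fin n → Fin n → Set) : Set where
  field
    ≤-refl    : ∀ e → e ≤ e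
    ≤-antisym : ∀ {e e'} → e ≤ e' → e' ≤ e → e ≡ e'
    ≤-trans   : ∀ {e e' e''} → e ≤ e' → e' ≤ e'' → e ≤ e''
    #-irrefl  : ∀ e → ¬ (e # e)
    #-sym     : ∀ {e e'} → e # e' → e' # e
    #-inherit : ∀ {e e' e''} → e # e' → e' ≤ e'' → e # e''

IsConfiguration : ∀ {n} (_≤_ : Fin n → Fin n → Set) (_#_ : Fin n → Fin n → Set)
                  → (Fin n → Bool) → Set
IsConfiguration {n} _≤_ _#_ c =
  ((e e' : Fin n) → c e ≡ true → c e' ≡ true → ¬ (e # e')) ×
  ((e e' : Fin n) → c e ≡ true → e' ≤ e → c e' ≡ true)

≤₀ : ∀ {n} → Formula n → Fin n → Fin n → Set
≤₀ φ i j = Contains φ (pos i) (neg j)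

#₀ : ∀ {n} → Formula n → Fin n → Fin n → Set
#₀ φ i j = Contains φ (neg i) (neg j)

≤φ : ∀ {n} → Formula n → Fin n → Fin n → Set
≤φ φ = Star (≤₀ φ)

#φ : ∀ {n} → Formula n → Fin n → Fin n → Set
#φ φ j l = ∃[ i ] ∃[ k ] (≤φ φ i j × ≤φ φ k l × #₀ φ i k)

-- A clause x_i ∨ ¬x_j of φ is the edge e_i ≤₀ e_j and a clause ¬x_i ∨ ¬x_j is the
-- basic conflict e_i #₀ e_j; with no positive clauses these are all the clauses, so
-- satisfying φ means being downward closed along ≤₀ and free of #₀, and both
-- properties propagate to the closures ≤ and #. The only axioms needing the
-- hypotheses on φ are antisymmetry and irreflexivity: a cycle e ≤ e' ≤ e forces
-- x_e = x_e' in every solution, and e # e forces x_e = 0 in every solution.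
module Submission where

open import Defs
open import Data.Nat using (ℕ)
open import Data.Fin using (_≟_)
open import Data.Bool using (Bool; true; false; not)
open import Data.Bool.Properties using (¬-not)
open import Data.List.Membership.Propositional using (_∈_)
import Data.List.Relation.Unary.All as All
open import Data.Product using (_×_; _,_)
open import Data.Sum using (inj₁; inj₂)
open import Data.Empty using (⊥; ⊥-elim)
open import Relation.Nullary using (¬_)
open import Relation.Nullary.Decidable using (decidable-stable)
open import Relation.Binary.PropositionalEquality using (_≡_; _≢_; refl; sym)
open import Relation.Binary.Construct.Closure.ReflexiveTransitive using (ε; _◅_; _◅◅_)
open import Function.Bundles using (_⇔_; mk⇔)

not≡true⇒≢true : ∀ {b} → not b ≡ true → b ≢ true
not≡true⇒≢true {false} _ ()

≡-from-≡true-⇔ : ∀ {a b : Bool} → (a ≡ true → b ≡ true) → (b ≡ true → a ≡ true) → a ≡ b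
≡-from-≡true-⇔ {true}          a⇒b _   = sym (a⇒b refl)
≡-from-≡true-⇔ {false} {true}  _   b⇒a = b⇒a refl
≡-from-≡true-⇔ {false} {false} _   _   = refl

module _ {n : ℕ} {φ : Formula n} where

  Solution-Contains : ∀ {S l₁ l₂} → Solution φ S → Contains φ l₁ l₂ → satClause S (l₁ , l₂)
  Solution-Contains sol (inj₁ l₁l₂∈φ) = All.lookup sol l₁l₂∈φ
  Solution-Contains sol (inj₂ l₂l₁∈φ) with All.lookup sol l₂l₁∈φ
  ... | inj₁ l₂-true = inj₂ l₂-true
  ... | inj₂ l₁-true = inj₁ l₁-true

  #₀-sym : ∀ {i k} → #₀ φ i k → #₀ φ k i
  #₀-sym (inj₁ m) = inj₂ m
  #₀-sym (inj₂ m) = inj₁ m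

  #φ-sym : ∀ {j l} → #φ φ j l → #φ φ l j
  #φ-sym (i , k , i≤j , k≤l , i#₀k) = k , i , k≤l , i≤j , #₀-sym i#₀k

  #φ-inherit : ∀ {j l l'} → #φ φ j l → ≤φ φ l l' → #φ φ j l'
  #φ-inherit (i , k , i≤j , k≤l , i#₀k) l≤l' = i , k , i≤j , k≤l ◅◅ l≤l' , i#₀k

  module _ {S : Assignment n} (sol : Solution φ S) where

    Solution-downward : ∀ {i j} → ≤φ φ i j → S j ≡ true → S i ≡ true
    Solution-downward ε             Sj = Sj
    Solution-downward (i≤₀m ◅ m≤j) Sj with Solution-Contains sol i≤₀m
    ... | inj₁ Si  = Si
    ... | inj₂ ¬Sm = ⊥-elim (not≡true⇒≢true ¬Sm (Solution-downward m≤j Sj))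

    Solution-#₀-free : ∀ {i k} → #₀ φ i k → S i ≡ true → S k ≡ true → ⊥
    Solution-#₀-free i#₀k Si Sk with Solution-Contains sol i#₀k
    ... | inj₁ ¬Si = not≡true⇒≢true ¬Si Si
    ... | inj₂ ¬Sk = not≡true⇒≢true ¬Sk Sk

    Solution-#φ-free : ∀ {j l} → #φ φ j l → S j ≡ true → S l ≡ true → ⊥
    Solution-#φ-free (i , k , i≤j , k≤l , i#₀k) Sj Sl =
      Solution-#₀-free i#₀k (Solution-downward i≤j Sj) (Solution-downward k≤l Sl)

    Solution⇒IsConfiguration : IsConfiguration (≤φ φ) (#φ φ) S
    Solution⇒IsConfiguration =
        (λ _ _ Se Se' e#e' → Solution-#φ-free e#e' Se Se')
      , (λ _ _ Se e'≤e → Solution-downward e'≤e Se)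

  ≤φ-cycle⇒Equal : ∀ {e e'} → ≤φ φ e e' → ≤φ φ e' e → ∀ S → Solution φ S → S e ≡ S e'
  ≤φ-cycle⇒Equal e≤e' e'≤e S sol =
    ≡-from-≡true-⇔ (Solution-downward sol e'≤e) (Solution-downward sol e≤e')

  ≤φ-antisym : NoTrivialVars φ → NoEquivalentVars φ → ∀ {e e'} → ≤φ φ e e' → ≤φ φ e' e → e ≡ e'
  ≤φ-antisym nt ne {e} {e'} e≤e' e'≤e = decidable-stable (e ≟ e') λ e≢e' →
    ne e e' e≢e' (nt e , nt e' , inj₁ (≤φ-cycle⇒Equal e≤e' e'≤e))

  #φ-irrefl : NoTrivialVars φ → ∀ e → ¬ #φ φ e e
  #φ-irrefl nt e e#e = nt e (false , λ S sol → ¬-not (λ Se → Solution-#φ-free sol e#e Se Se))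

  isEventStructure : NoTrivialVars φ → NoEquivalentVars φ → IsEventStructure n (≤φ φ) (#φ φ)
  isEventStructure nt ne = record
    { ≤-refl    = λ _ → ε
    ; ≤-antisym = ≤φ-antisym nt ne
    ; ≤-trans   = _◅◅_
    ; #-irrefl  = #φ-irrefl nt
    ; #-sym     = #φ-sym
    ; #-inherit = #φ-inherit
    }

  IsConfiguration⇒Solution : NoPositiveClauses φ → ∀ {S} → IsConfiguration (≤φ φ) (#φ φ) S → Solution φ S
  IsConfiguration⇒Solution np {S} (conflict-free , downward) = All.tabulate satisfied
    where
    satisfied : ∀ {c} → c ∈ φ → satClause S c
    satisfied {pos i , pos j} c∈φ = ⊥-elim (np i j (inj₁ c∈φ))
    satisfied {pos i , neg j} c∈φ with S j in Sj
    ... | true  = inj₁ (downward j i Sj (inj₁ c∈φ ◅ ε))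
    ... | false = inj₂ refl
    satisfied {neg i , pos j} c∈φ with S i in Si
    ... | true  = inj₂ (downward i j Si (inj₂ c∈φ ◅ ε))
    ... | false = inj₁ refl
    satisfied {neg i , neg j} c∈φ with S i in Si | S j in Sj
    ... | true  | true  = ⊥-elim (conflict-free i j Si Sj (i , j , ε , ε , inj₁ c∈φ))
    ... | true  | false = inj₂ refl
    ... | false | _     = inj₁ refl

proposition7p6 : (n : ℕ) (φ : Formula n)
    → NoTrivialVars φ → NoEquivalentVars φ → NoPositiveClauses φ
    → IsEventStructure n (≤φ φ) (#φ φ)
    × ((S : Assignment n) → IsConfiguration (≤φ φ) (#φ φ) S ⇔ Solution φ S)
proposition7p6 n φ nt ne np =
    isEventStructure nt ne
  , λ S → mk⇔ (IsConfiguration⇒Solution np) Solution⇒IsConfiguration
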